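{- Let $t\geq 1$, $T=\{1,\ldots,t\}$, and let $\mathcal{F}$ be a family of subsets of $T$. Then there exist sets $A_1,A_2,\ldots,A_t$ such that for every $X \subseteq T$: $$ X \text{ does not contain any } F \in \mathcal{F} \iff \bigcap_{i\in X}A_i \neq \emptyset .$$ Furthermore, $\left|\bigcup_{i=1}^t A_i\right| \leq \binom{t}{\lfloor t/2 \rfloor}$. -}

module Defs where

open import Data.Nat using (ℕ)
open import Data.Fin using (Fin)
open import Data.Fin.Subset using (Subset; _∈_; _⊆_; ⋃; ∣_∣)
open import Data.List using (List; map; allFin)
open import Data.List.Membership.Propositional using () renaming (_∈_ to _∈ˡ_)
open import Data.Product using (∃; _×_)
open import Relation.Nullary using (¬_)

ContainsMember : ∀ {t} → List (Subset t) → Subset t → Set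
ContainsMember 𝓕 X = ∃ λ F → F ∈ˡ 𝓕 × F ⊆ X

-- ⋂_{i ∈ X} A i  is nonempty (empty intersection = whole ground set Fin m)
InterNonempty : ∀ {t m} → (Fin t → Subset m) → Subset t → Set
InterNonempty A X = ∃ λ x → ∀ i → i ∈ X → x ∈ A i

BigUnion : ∀ {t m} → (Fin t → Subset m) → Subset m
BigUnion {t} A = ⋃ (map A (allFin t))

{-# OPTIONS --safe #-}
module Submission where

-- Call X ⊆ T independent if it contains no member of 𝓕; subsets of independent sets are
-- independent.  Index the ground set by the maximal independent sets and let A i consist of
-- those containing i: the A i with i ∈ X share a point iff X lies in a maximal independent
-- set, i.e. iff X is independent.  Distinct maximal independent sets are incomparable, so by
-- Sperner's theorem there are at most t C ⌊t/2⌋ of them.  Sperner's theorem follows from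
-- the LYM inequality  Σ_{A ∈ L} |A|! (n − |A|)! ≤ n!  for an antichain L, proved by induction
-- on n: unless ⊤ ∈ L (and then L = {⊤}), deleting a point i from the members of L avoiding it
-- gives an antichain on n − 1 points, and summing over i counts each A exactly n − |A| times,
-- which turns the weights on n − 1 points into those on n points.

open import Defs
open import Data.Bool as Bool using (if_then_else_)
open import Data.Fin using (Fin; zero; suc; punchOut)
open import Data.Fin.Properties using (all?)
open import Data.Fin.Subset using (Subset; _∈_; _∉_; _⊆_; _∪_; ⁅_⁆; ⊤; ∣_∣; inside; outside)
open import Data.Fin.Subset.Properties
  using (_∈?_; _⊆?_; ⊆-trans; ⊆-antisym; ⊆⊤; p⊆p∪q; x∈p∪q⁺; x∈p∪q⁻; x∈⁅x⁆; x∈⁅y⁆⇒x≡y; ∣p∣≤n; ∣⊤∣≡n; ∣p∣≡n⇒p≡⊤)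
open import Data.List as List using (List; []; _∷_; length; map; filter; allFin; cartesianProductWith)
open import Data.List.Membership.Propositional using (find; lose) renaming (_∈_ to _∈ˡ_)
open import Data.List.Membership.Propositional.Properties
  using (∈-allFin; ∈-filter⁺; ∈-lookup; ∈-cartesianProductWith⁺)
open import Data.List.Relation.Unary.All as All using (All; []; _∷_)
open import Data.List.Relation.Unary.All.Properties using (all-filter)
open import Data.List.Relation.Unary.AllPairs using (AllPairs; []; _∷_)
open import Data.List.Relation.Unary.Any using (here; there; any?; index)
open import Data.List.Relation.Unary.Any.Properties using (lookup-index)
open import Data.List.Relation.Unary.Unique.Propositional using (Unique)
import Data.List.Relation.Unary.Unique.Propositional.Properties as Unique
open import Data.Nat using (ℕ; zero; suc; _+_; _*_; _∸_; _≤_; _<_; _!; _/_; ⌊_/2⌋; ⌈_/2⌉; z≤n; s≤s; s≤s⁻¹)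
open import Data.Nat.Combinatorics using (_C_; nCk≡n!/k![n-k]!; k![n∸k]!∣n!; [n-k]*[n-k-1]!≡[n-k]!)
open import Data.Nat.DivMod using (m/n*n≡m; m/n≡1+[m∸n]/n)
open import Data.Nat.ListAction using (sum)
open import Data.Nat.Properties
open import Algebra.Properties.CommutativeSemigroup *-commutativeSemigroup using (x∙yz≈y∙xz)
open import Algebra.Properties.CommutativeMonoid.Sum +-0-commutativeMonoid
  using (sum-syntax; sum-cong-≗; sum-replicate-zero; ∑-distrib-+)
open import Data.Product using (∃; _×_; _,_; proj₁)
open import Data.Empty using (⊥-elim)
open import Data.Sum using (inj₁; inj₂)
open import Data.Vec as Vec using (_∷_; []; lookup; tabulate; removeAt)
open import Data.Vec.Properties
  using (∷-injective; ≡-dec; []=⇒lookup; lookup⇒[]=; lookup∘tabulate; removeAt-punchOut)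
open import Function using (_∘_)
open import Function.Bundles using (_⇔_; mk⇔)
open import Relation.Nullary using (¬_; Dec; yes; no; does; contradiction)
open import Relation.Nullary.Decidable using (map′; ¬?; _×-dec_; _→-dec_)
open import Relation.Binary.PropositionalEquality

n/2≡⌊n/2⌋ : ∀ n → n / 2 ≡ ⌊ n /2⌋
n/2≡⌊n/2⌋ zero = refl
n/2≡⌊n/2⌋ (suc zero) = refl
n/2≡⌊n/2⌋ (suc (suc n)) = trans (m/n≡1+[m∸n]/n {suc (suc n)} {2} (s≤s (s≤s z≤n))) (cong suc (n/2≡⌊n/2⌋ n))

n∸⌊n/2⌋≡⌈n/2⌉ : ∀ n → n ∸ ⌊ n /2⌋ ≡ ⌈ n /2⌉
n∸⌊n/2⌋≡⌈n/2⌉ n = trans (cong (_∸ ⌊ n /2⌋) (sym (⌊n/2⌋+⌈n/2⌉≡n n))) (m+n∸m≡n ⌊ n /2⌋ ⌈ n /2⌉)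

⌈n/2⌉≤1+⌊n/2⌋ : ∀ n → ⌈ n /2⌉ ≤ suc ⌊ n /2⌋
⌈n/2⌉≤1+⌊n/2⌋ zero = z≤n
⌈n/2⌉≤1+⌊n/2⌋ (suc zero) = ≤-refl
⌈n/2⌉≤1+⌊n/2⌋ (suc (suc n)) = s≤s (⌈n/2⌉≤1+⌊n/2⌋ n)

n!≡nCk*k![n∸k]! : ∀ {n k} → k ≤ n → n ! ≡ (n C k) * (k ! * (n ∸ k) !)
n!≡nCk*k![n∸k]! {n} {k} k≤n = sym (trans (cong (_* (k ! * (n ∸ k) !)) (nCk≡n!/k![n-k]! k≤n))
                                           (m/n*n≡m {{k !* (n ∸ k) !≢0}} (k![n∸k]!∣n! k≤n)))

[1+a]!b!≤a![1+b]! : ∀ {a b} → a ≤ b → suc a ! * b ! ≤ a ! * suc b !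
[1+a]!b!≤a![1+b]! {a} {b} a≤b = begin
  suc a ! * b !         ≡⟨ *-assoc (suc a) (a !) (b !) ⟩
  suc a * (a ! * b !)   ≤⟨ *-monoˡ-≤ (a ! * b !) (s≤s a≤b) ⟩
  suc b * (a ! * b !)   ≡⟨ x∙yz≈y∙xz (suc b) (a !) (b !) ⟩
  a ! * suc b !         ∎
  where open ≤-Reasoning

[a+k]!d!≤a![k+d]! : ∀ a k d → a + k ≤ suc d → (a + k) ! * d ! ≤ a ! * (k + d) !
[a+k]!d!≤a![k+d]! a zero d _ rewrite +-identityʳ a = ≤-refl
[a+k]!d!≤a![k+d]! a (suc k) d a+k<2+d rewrite +-suc a k = begin
  (suc a + k) ! * d !   ≤⟨ [a+k]!d!≤a![k+d]! (suc a) k d a+k<2+d ⟩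
  suc a ! * (k + d) !   ≤⟨ [1+a]!b!≤a![1+b]! a≤k+d ⟩
  a ! * suc (k + d) !   ∎
  where
  open ≤-Reasoning
  a≤k+d : a ≤ k + d
  a≤k+d = ≤-trans (m≤m+n a k) (≤-trans (s≤s⁻¹ a+k<2+d) (m≤n+m d k))

!*!-minimalˡ : ∀ {a b h h′} → a ≤ h → h ≤ h′ → a + b ≡ h + h′ → h ! * h′ ! ≤ a ! * b !
!*!-minimalˡ {a} {b} {h′ = h′} a≤h h≤h′ a+b≡h+h′ with m≤n⇒∃[o]m+o≡n a≤h
... | k , refl = subst (λ b → (a + k) ! * h′ ! ≤ a ! * b !) k+h′≡b ([a+k]!d!≤a![k+d]! a k h′ (m≤n⇒m≤1+n h≤h′))
  where
  k+h′≡b : k + h′ ≡ b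
  k+h′≡b = +-cancelˡ-≡ a _ _ (trans (sym (+-assoc a k h′)) (sym a+b≡h+h′))

!*!-minimal : ∀ {a b h h′} → h ≤ h′ → h′ ≤ suc h → a + b ≡ h + h′ → h ! * h′ ! ≤ a ! * b !
!*!-minimal {a} {b} {h} {h′} h≤h′ h′≤1+h a+b≡h+h′ with a ≤? h
... | yes a≤h = !*!-minimalˡ a≤h h≤h′ a+b≡h+h′
... | no a≰h = subst (h ! * h′ ! ≤_) (*-comm (b !) (a !)) (!*!-minimalˡ b≤h h≤h′ (trans (+-comm b a) a+b≡h+h′))
  where
  open ≤-Reasoning
  -- a + b = h + h′ ≤ 2h + 1, so a ≤ h or b ≤ h.
  b≤h : b ≤ h
  b≤h = +-cancelʳ-≤ h′ b h (begin
    b + h′   ≤⟨ +-monoʳ-≤ b (≤-trans h′≤1+h (≰⇒> a≰h)) ⟩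
    b + a    ≡⟨ +-comm b a ⟩
    a + b    ≡⟨ a+b≡h+h′ ⟩
    h + h′   ∎)

⌊n/2⌋!⌈n/2⌉!≤k![n∸k]! : ∀ {n k} → k ≤ n → ⌊ n /2⌋ ! * ⌈ n /2⌉ ! ≤ k ! * (n ∸ k) !
⌊n/2⌋!⌈n/2⌉!≤k![n∸k]! {n} {k} k≤n =
  !*!-minimal {k} {n ∸ k} (⌊n/2⌋≤⌈n/2⌉ n) (⌈n/2⌉≤1+⌊n/2⌋ n) (trans (m+[n∸m]≡n k≤n) (sym (⌊n/2⌋+⌈n/2⌉≡n n)))

∑-bounded : ∀ {n c} (f : Fin n → ℕ) → (∀ i → f i ≤ c) → ∑[ i < n ] f i ≤ n * c
∑-bounded {zero} f f≤c = z≤n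
∑-bounded {suc n} f f≤c = +-mono-≤ (f≤c zero) (∑-bounded (f ∘ suc) (f≤c ∘ suc))

∑-∉ : ∀ {n} (p : Subset n) c → ∑[ i < n ] (if does (i ∈? p) then 0 else c) ≡ (n ∸ ∣ p ∣) * c
∑-∉ [] c = refl
∑-∉ (inside ∷ p) c = ∑-∉ p c
∑-∉ {suc n} (outside ∷ p) c = trans (cong (c +_) (∑-∉ p c)) (cong (_* c) (sym (+-∸-assoc 1 (∣p∣≤n p))))

length*≤sum : ∀ {A : Set} {c} (f : A → ℕ) → (∀ x → c ≤ f x) → ∀ xs → length xs * c ≤ sum (map f xs)
length*≤sum f c≤f [] = z≤n
length*≤sum f c≤f (x ∷ xs) = +-mono-≤ (c≤f x) (length*≤sum f c≤f xs)

∣removeAt∣≡∣p∣ : ∀ {n} (p : Subset (suc n)) {i} → i ∉ p → ∣ removeAt p i ∣ ≡ ∣ p ∣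
∣removeAt∣≡∣p∣ (outside ∷ p) {zero} _ = refl
∣removeAt∣≡∣p∣ (inside ∷ p) {zero} i∉p = contradiction Vec.here i∉p
∣removeAt∣≡∣p∣ (outside ∷ p@(_ ∷ _)) {suc i} i∉p = ∣removeAt∣≡∣p∣ p (i∉p ∘ Vec.there)
∣removeAt∣≡∣p∣ (inside ∷ p@(_ ∷ _)) {suc i} i∉p = cong suc (∣removeAt∣≡∣p∣ p (i∉p ∘ Vec.there))

removeAt-⊆⁻ : ∀ {n} {p q : Subset (suc n)} {i} → i ∉ p → removeAt p i ⊆ removeAt q i → p ⊆ q
removeAt-⊆⁻ {p = p} {q} {i} i∉p p-i⊆q-i {x} x∈p = lookup⇒[]= x q (begin
  lookup q x                             ≡⟨ removeAt-punchOut q i≢x ⟨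
  lookup (removeAt q i) (punchOut i≢x)   ≡⟨ []=⇒lookup (p-i⊆q-i (lookup⇒[]= _ _ x∈p-i)) ⟩
  inside                                 ∎)
  where
  open ≡-Reasoning
  i≢x : i ≢ x
  i≢x refl = i∉p x∈p
  x∈p-i : lookup (removeAt p i) (punchOut i≢x) ≡ inside
  x∈p-i = trans (removeAt-punchOut p i≢x) ([]=⇒lookup x∈p)

Incomparable : ∀ {n} → Subset n → Subset n → Set
Incomparable p q = ¬ p ⊆ q × ¬ q ⊆ p

Antichain : ∀ {n} → List (Subset n) → Set
Antichain = AllPairs Incomparable

antichain-∋⊤ : ∀ {n} {L : List (Subset n)} → Antichain L → ⊤ ∈ˡ L → L ≡ ⊤ ∷ []
antichain-∋⊤ {L = _ ∷ []} _ (here refl) = refl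
antichain-∋⊤ {L = _ ∷ _ ∷ _} (((_ , ⊤⊈B) ∷ _) ∷ _) (here refl) = ⊥-elim (⊤⊈B ⊆⊤)
antichain-∋⊤ (A∥L ∷ _) (there ⊤∈L) = ⊥-elim (proj₁ (All.lookup A∥L ⊤∈L) ⊆⊤)

deletion : ∀ {n} → Fin (suc n) → List (Subset (suc n)) → List (Subset n)
deletion i [] = []
deletion i (A ∷ L) with i ∈? A
... | yes _ = deletion i L
... | no _ = removeAt A i ∷ deletion i L

deletion-antichain : ∀ {n} i {L : List (Subset (suc n))} → Antichain L → Antichain (deletion i L)
deletion-antichain i {[]} [] = []
deletion-antichain i {A ∷ L} (A∥L ∷ L-antichain) with i ∈? A
... | yes _ = deletion-antichain i L-antichain
... | no i∉A = deletion-incomparable A∥L ∷ deletion-antichain i L-antichain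
  where
  deletion-incomparable : ∀ {L} → All (Incomparable A) L → All (Incomparable (removeAt A i)) (deletion i L)
  deletion-incomparable {[]} [] = []
  deletion-incomparable {B ∷ L} ((A⊈B , B⊈A) ∷ A∥L) with i ∈? B
  ... | yes _ = deletion-incomparable A∥L
  ... | no i∉B = (A⊈B ∘ removeAt-⊆⁻ i∉A , B⊈A ∘ removeAt-⊆⁻ i∉B) ∷ deletion-incomparable A∥L

lymWeight : ∀ n → Subset n → ℕ
lymWeight n A = ∣ A ∣ ! * (n ∸ ∣ A ∣) !

lymSum : ∀ n → List (Subset n) → ℕ
lymSum n L = sum (map (lymWeight n) L)

lymSum-[⊤] : ∀ n → lymSum n (⊤ ∷ []) ≡ n !
lymSum-[⊤] n rewrite ∣⊤∣≡n n | n∸n≡0 n = trans (+-identityʳ _) (*-identityʳ (n !))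

lymSum-deletion-∷ : ∀ {k} i (A : Subset (suc k)) L →
  lymSum k (deletion i (A ∷ L)) ≡ (if does (i ∈? A) then 0 else ∣ A ∣ ! * (k ∸ ∣ A ∣) !) + lymSum k (deletion i L)
lymSum-deletion-∷ {k} i A L with i ∈? A
... | yes _ = refl
... | no i∉A = cong (λ s → s ! * (k ∸ s) ! + lymSum k (deletion i L)) (∣removeAt∣≡∣p∣ A i∉A)

∑-lymWeight-deletion : ∀ {k} (A : Subset (suc k)) → ∣ A ∣ < suc k →
  ∑[ i < suc k ] (if does (i ∈? A) then 0 else ∣ A ∣ ! * (k ∸ ∣ A ∣) !) ≡ lymWeight (suc k) A
∑-lymWeight-deletion {k} A ∣A∣<1+k = begin
  ∑[ i < suc k ] (if does (i ∈? A) then 0 else s ! * (k ∸ s) !)  ≡⟨ ∑-∉ A (s ! * (k ∸ s) !) ⟩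
  (suc k ∸ s) * (s ! * (k ∸ s) !)                                ≡⟨ x∙yz≈y∙xz (suc k ∸ s) (s !) ((k ∸ s) !) ⟩
  s ! * ((suc k ∸ s) * (k ∸ s) !)                                ≡⟨ cong (s ! *_) ([n-k]*[n-k-1]!≡[n-k]! ∣A∣<1+k) ⟩
  s ! * (suc k ∸ s) !                                            ∎
  where
  open ≡-Reasoning
  s = ∣ A ∣

∑-lymSum-deletion : ∀ {k} (L : List (Subset (suc k))) → All (λ A → ∣ A ∣ < suc k) L →
  ∑[ i < suc k ] lymSum k (deletion i L) ≡ lymSum (suc k) L
∑-lymSum-deletion {k} [] [] = sum-replicate-zero (suc k)
∑-lymSum-deletion {k} (A ∷ L) (∣A∣<1+k ∷ ∣L∣<1+k) = begin
  ∑[ i < suc k ] lymSum k (deletion i (A ∷ L))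
    ≡⟨ sum-cong-≗ (λ i → lymSum-deletion-∷ i A L) ⟩
  ∑[ i < suc k ] (a i + lymSum k (deletion i L))
    ≡⟨ ∑-distrib-+ a (λ i → lymSum k (deletion i L)) ⟩
  ∑[ i < suc k ] a i + ∑[ i < suc k ] lymSum k (deletion i L)
    ≡⟨ cong₂ _+_ (∑-lymWeight-deletion A ∣A∣<1+k) (∑-lymSum-deletion L ∣L∣<1+k) ⟩
  lymWeight (suc k) A + lymSum (suc k) L
    ∎
  where
  open ≡-Reasoning
  a : Fin (suc k) → ℕ
  a i = if does (i ∈? A) then 0 else ∣ A ∣ ! * (k ∸ ∣ A ∣) !

lym : ∀ n (L : List (Subset n)) → Antichain L → lymSum n L ≤ n !
lym n L L-antichain with any? (≡-dec Bool._≟_ ⊤) L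
... | yes ⊤∈L = ≤-reflexive (trans (cong (lymSum n) (antichain-∋⊤ L-antichain ⊤∈L)) (lymSum-[⊤] n))
lym zero [] _ | no _ = z≤n
lym zero ([] ∷ _) _ | no ⊤∉L = contradiction (here refl) ⊤∉L
lym (suc k) L L-antichain | no ⊤∉L = begin
  lymSum (suc k) L
    ≡⟨ ∑-lymSum-deletion L (All.tabulate proper) ⟨
  ∑[ i < suc k ] lymSum k (deletion i L)
    ≤⟨ ∑-bounded _ (λ i → lym k (deletion i L) (deletion-antichain i L-antichain)) ⟩
  suc k * k !
    ∎
  where
  open ≤-Reasoning
  proper : ∀ {A} → A ∈ˡ L → ∣ A ∣ < suc k
  proper {A} A∈L = ≤∧≢⇒< (∣p∣≤n A) (λ ∣A∣≡n → ⊤∉L (subst (_∈ˡ L) (∣p∣≡n⇒p≡⊤ ∣A∣≡n) A∈L))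

sperner : ∀ {n} {L : List (Subset n)} → Antichain L → length L ≤ n C (n / 2)
sperner {n} {L} L-antichain rewrite n/2≡⌊n/2⌋ n =
  *-cancelʳ-≤ (length L) (n C h) (h ! * ⌈ n /2⌉ !) {{h !* ⌈ n /2⌉ !≢0}} (begin
    length L * (h ! * ⌈ n /2⌉ !)    ≤⟨ length*≤sum (lymWeight n) (λ A → ⌊n/2⌋!⌈n/2⌉!≤k![n∸k]! (∣p∣≤n A)) L ⟩
    lymSum n L                      ≤⟨ lym n L L-antichain ⟩
    n !                             ≡⟨ n!≡nCk*k![n∸k]! (⌊n/2⌋≤n n) ⟩
    (n C h) * (h ! * (n ∸ h) !)     ≡⟨ cong (λ h′ → (n C h) * (h ! * h′ !)) (n∸⌊n/2⌋≡⌈n/2⌉ n) ⟩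
    (n C h) * (h ! * ⌈ n /2⌉ !)     ∎)
  where
  open ≤-Reasoning
  h = ⌊ n /2⌋

allSubsets : ∀ n → List (Subset n)
allSubsets zero = [] ∷ []
allSubsets (suc n) = cartesianProductWith _∷_ (inside ∷ outside ∷ []) (allSubsets n)

∈-allSubsets : ∀ {n} (p : Subset n) → p ∈ˡ allSubsets n
∈-allSubsets [] = here refl
∈-allSubsets (b ∷ p) = ∈-cartesianProductWith⁺ _∷_ {xs = inside ∷ outside ∷ []} (∈-bits b) (∈-allSubsets p)
  where
  ∈-bits : ∀ b → b ∈ˡ inside ∷ outside ∷ []
  ∈-bits inside = here refl
  ∈-bits outside = there (here refl)

allSubsets-unique : ∀ n → Unique (allSubsets n)
allSubsets-unique zero = [] ∷ []
allSubsets-unique (suc n) =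
  Unique.cartesianProductWith⁺ _∷_ ∷-injective (((λ ()) ∷ []) ∷ [] ∷ []) (allSubsets-unique n)

∪⁅⁆-⊆ : ∀ {n} {p q : Subset n} {x} → p ⊆ q → x ∈ q → p ∪ ⁅ x ⁆ ⊆ q
∪⁅⁆-⊆ {p = p} {x = x} p⊆q x∈q y∈p∪x with x∈p∪q⁻ p ⁅ x ⁆ y∈p∪x
... | inj₁ y∈p = p⊆q y∈p
... | inj₂ y∈x rewrite x∈⁅y⁆⇒x≡y x y∈x = x∈q

dual : ∀ {t} (Ms : List (Subset t)) → Fin t → Subset (length Ms)
dual Ms i = tabulate (λ k → lookup (List.lookup Ms k) i)

∈-dual⁺ : ∀ {t} (Ms : List (Subset t)) {i k} → i ∈ List.lookup Ms k → k ∈ dual Ms i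
∈-dual⁺ _ {k = k} i∈M = lookup⇒[]= k _ (trans (lookup∘tabulate _ k) ([]=⇒lookup i∈M))

∈-dual⁻ : ∀ {t} (Ms : List (Subset t)) {i k} → k ∈ dual Ms i → i ∈ List.lookup Ms k
∈-dual⁻ _ {i} {k} k∈A = lookup⇒[]= i _ (trans (sym (lookup∘tabulate _ k)) ([]=⇒lookup k∈A))

module MaximalSets {t} {P : Subset t → Set} (P? : ∀ X → Dec (P X))
                   (P-⊆ : ∀ {X Y} → Y ⊆ X → P X → P Y) where

  Maximal : Subset t → Set
  Maximal X = P X × (∀ j → P (X ∪ ⁅ j ⁆) → j ∈ X)

  maximal? : ∀ X → Dec (Maximal X)
  maximal? X = P? X ×-dec all? (λ j → P? (X ∪ ⁅ j ⁆) →-dec j ∈? X)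

  maximal-⊆⇒≡ : ∀ {M X} → Maximal M → P X → M ⊆ X → M ≡ X
  maximal-⊆⇒≡ (_ , saturated) PX M⊆X = ⊆-antisym M⊆X (λ x∈X → saturated _ (P-⊆ (∪⁅⁆-⊆ M⊆X x∈X) PX))

  maximal-incomparable : ∀ {M N} → Maximal M → Maximal N → M ≢ N → Incomparable M N
  maximal-incomparable mM mN M≢N =
    (λ M⊆N → M≢N (maximal-⊆⇒≡ mM (proj₁ mN) M⊆N)) , (λ N⊆M → M≢N (sym (maximal-⊆⇒≡ mN (proj₁ mM) N⊆M)))

  greedy : Subset t → List (Fin t) → Subset t
  greedy X [] = X
  greedy X (j ∷ js) with P? (X ∪ ⁅ j ⁆)
  ... | yes _ = greedy (X ∪ ⁅ j ⁆) js
  ... | no _ = greedy X js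

  ⊆-greedy : ∀ X js → X ⊆ greedy X js
  ⊆-greedy X [] = λ x∈X → x∈X
  ⊆-greedy X (j ∷ js) with P? (X ∪ ⁅ j ⁆)
  ... | yes _ = ⊆-trans (p⊆p∪q ⁅ j ⁆) (⊆-greedy (X ∪ ⁅ j ⁆) js)
  ... | no _ = ⊆-greedy X js

  P-greedy : ∀ {X} js → P X → P (greedy X js)
  P-greedy [] PX = PX
  P-greedy {X} (j ∷ js) PX with P? (X ∪ ⁅ j ⁆)
  ... | yes PX∪j = P-greedy js PX∪j
  ... | no _ = P-greedy js PX

  greedy-saturated : ∀ X {js j} → j ∈ˡ js → P (greedy X js ∪ ⁅ j ⁆) → j ∈ greedy X js
  greedy-saturated X {j′ ∷ js} j∈js P[G∪j] with P? (X ∪ ⁅ j′ ⁆) | j∈js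
  ... | yes _ | here refl = ⊆-greedy (X ∪ ⁅ j′ ⁆) js (x∈p∪q⁺ (inj₂ (x∈⁅x⁆ j′)))
  ... | yes _ | there j∈js′ = greedy-saturated (X ∪ ⁅ j′ ⁆) j∈js′ P[G∪j]
  ... | no ¬PX∪j | here refl =
    contradiction (P-⊆ (∪⁅⁆-⊆ (⊆-trans (⊆-greedy X js) (p⊆p∪q _)) (x∈p∪q⁺ (inj₂ (x∈⁅x⁆ j′)))) P[G∪j]) ¬PX∪j
  ... | no _ | there j∈js′ = greedy-saturated X j∈js′ P[G∪j]

  maximal-extension : ∀ {X} → P X → ∃ λ M → Maximal M × X ⊆ M
  maximal-extension {X} PX =
    greedy X (allFin t) , (P-greedy (allFin t) PX , λ j → greedy-saturated X (∈-allFin j)) , ⊆-greedy X (allFin t)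

  maximalSets : List (Subset t)
  maximalSets = filter maximal? (allSubsets t)

  maximalSets-maximal : All Maximal maximalSets
  maximalSets-maximal = all-filter maximal? (allSubsets t)

  ∈-maximalSets : ∀ {M} → Maximal M → M ∈ˡ maximalSets
  ∈-maximalSets {M} = ∈-filter⁺ maximal? (∈-allSubsets M)

  maximalSets-antichain : Antichain maximalSets
  maximalSets-antichain =
    distinct⇒antichain maximalSets-maximal (Unique.filter⁺ maximal? (allSubsets-unique t))
    where
    distinct⇒antichain : ∀ {Ms} → All Maximal Ms → Unique Ms → Antichain Ms
    distinct⇒antichain [] [] = []
    distinct⇒antichain (mM ∷ mMs) (M≢Ms ∷ Ms-unique) =
      All.zipWith (λ (mN , M≢N) → maximal-incomparable mM mN M≢N) (mMs , M≢Ms)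
      ∷ distinct⇒antichain mMs Ms-unique

  nerve-representation : ∃ λ m → ∃ λ (A : Fin t → Subset m) →
    (∀ X → P X ⇔ InterNonempty A X) × m ≤ t C (t / 2)
  nerve-representation =
    length maximalSets , dual maximalSets , (λ X → mk⇔ P⇒inter inter⇒P) , sperner maximalSets-antichain
    where
    P⇒inter : ∀ {X} → P X → InterNonempty (dual maximalSets) X
    P⇒inter PX with maximal-extension PX
    ... | M , mM , X⊆M = index M∈ , λ i i∈X → ∈-dual⁺ maximalSets (subst (i ∈_) (lookup-index M∈) (X⊆M i∈X))
      where M∈ = ∈-maximalSets mM
    inter⇒P : ∀ {X} → InterNonempty (dual maximalSets) X → P X
    inter⇒P (k , k∈A) =
      P-⊆ (λ {i} i∈X → ∈-dual⁻ maximalSets (k∈A i i∈X)) (proj₁ (All.lookup maximalSets-maximal (∈-lookup k)))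

containsMember? : ∀ {t} (𝓕 : List (Subset t)) X → Dec (ContainsMember 𝓕 X)
containsMember? 𝓕 X = map′ find (λ (F , F∈𝓕 , F⊆X) → lose F∈𝓕 F⊆X) (any? (_⊆? X) 𝓕)

containsMember-⊆ : ∀ {t} {𝓕 : List (Subset t)} {X Y} → X ⊆ Y → ContainsMember 𝓕 X → ContainsMember 𝓕 Y
containsMember-⊆ X⊆Y (F , F∈𝓕 , F⊆X) = F , F∈𝓕 , ⊆-trans F⊆X X⊆Y

lemma2p2 : (t : ℕ) → 1 ≤ t → (𝓕 : List (Subset t)) →
    ∃ λ (m : ℕ) → ∃ λ (A : Fin t → Subset m) →
      (∀ (X : Subset t) → (¬ ContainsMember 𝓕 X) ⇔ InterNonempty A X)
      × ∣ BigUnion A ∣ ≤ t C (t / 2)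
-- The bound does not need t ≥ 1.
lemma2p2 t _ 𝓕 =
  let m , A , independent⇔inter , m≤tCt/2 = nerve-representation
  in  m , A , independent⇔inter , ≤-trans (∣p∣≤n (BigUnion A)) m≤tCt/2
  where
  open MaximalSets (λ X → ¬? (containsMember? 𝓕 X)) (λ Y⊆X ¬𝓕X 𝓕Y → ¬𝓕X (containsMember-⊆ Y⊆X 𝓕Y))
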